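{- Let $G$ be a graph, $\gamma:E(G)\to\mathrm{GF}(2)^t$, $\alpha\in\mathrm{GF}(2)^t$, and $T=\{u,v\}$ a two-element subset of $V(G)$. Then $\tilde w_T(\alpha)$ equals the minimum of $w_{uv}(\beta)+\tilde w(\alpha+\beta)$ taken over all $\beta\in\mathrm{GF}(2)^t$.
   Context: For $F\subseteq E(G)$, $\gamma(F)=\sum_{e\in F}\gamma(e)$. For $T\subseteq V(G)$, a $T$-join is a set $J\subseteq E(G)$ such that $T$ is exactly the set of odd-degree vertices of the spanning subgraph $(V(G),J)$; $\tilde w_T(\beta)$ is the minimum size of a $T$-join $J$ with $\gamma(J)=\beta$ ($\infty$ if none). A cycle is an $\emptyset$-join. A $(u,v)$-walk is a sequence $(v_0,e_1,v_1,\ldots,e_k,v_k)$ with $v_0=u$, $v_k=v$ and each $e_i$ an edge with ends $v_{i-1},v_i$; its length is $k$ and parity $\gamma(e_1)+\cdots+\gamma(e_k)$. $w_{uv}(\beta)$ is the minimum length of a $(u,v)$-walk of parity $\beta$ ($\infty$ if none). A closed walk is a $(x,x)$-walk; $w(\beta)$ is the minimum length of a closed walk of parity $\beta$ ($\infty$ if none), and $\tilde w(\beta)$ is the minimum of $\sum_{\delta\in S}w(\delta)$ over subsets $S\subseteq\mathrm{GF}(2)^t$ with $\sum_{\delta\in S}\delta=\beta$. -}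

module Defs where

open import Data.Nat using (ℕ; zero; suc; _+_; _%_)
import Data.Nat as N
open import Data.Bool using (Bool; true; false; _xor_; if_then_else_)
open import Data.Fin using (Fin)
open import Data.Fin.Subset using (Subset; ∣_∣) renaming (_∈_ to _∈ₛ_)
open import Data.Vec using (Vec; replicate; zipWith; lookup)
open import Data.List using (List; []; _∷_; foldr; map; allFin)
open import Data.List.Relation.Unary.Unique.Propositional using (Unique)
open import Data.Product using (_×_; _,_; proj₁; proj₂; ∃; ∃-syntax; Σ-syntax)
open import Data.Sum using (_⊎_)
open import Relation.Binary.PropositionalEquality using (_≡_)
open import Relation.Nullary using (¬_; does)
open import Data.Fin using (_≟_)

-- Graphs: finite vertex set Fin n, finite edge set Fin m, each edge has
-- an (unordered) pair of ends; loops and parallel edges are allowed.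

record Graph : Set where
  field
    nV   : ℕ
    nE   : ℕ
    ends : Fin nE → Fin nV × Fin nV

open Graph public

V : Graph → Set
V G = Fin (nV G)

E : Graph → Set
E G = Fin (nE G)

GF2^ : ℕ → Set
GF2^ t = Vec Bool t

0v : ∀ {t} → GF2^ t
0v = replicate _ false

_⊕_ : ∀ {t} → GF2^ t → GF2^ t → GF2^ t
_⊕_ = zipWith _xor_

data ℕ∞ : Set where
  fin : ℕ → ℕ∞
  ∞   : ℕ∞

_+∞_ : ℕ∞ → ℕ∞ → ℕ∞
fin a +∞ fin b = fin (a + b)
fin _ +∞ ∞     = ∞
∞     +∞ _     = ∞

data _≤∞_ : ℕ∞ → ℕ∞ → Set where
  fin≤fin : ∀ {a b} → a N.≤ b → fin a ≤∞ fin b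
  _≤∞∞    : ∀ x → x ≤∞ ∞

-- m is the minimum of the set X ⊆ ℕ∞ (with min ∅ = ∞).
IsMin : (ℕ∞ → Set) → ℕ∞ → Set
IsMin X m = (X m ⊎ m ≡ ∞) × (∀ x → X x → m ≤∞ x)

module _ (G : Graph) where

  [_≟ᵇ_] : V G → V G → ℕ
  [ x ≟ᵇ y ] = if does (x ≟ y) then 1 else 0

  -- degree of x in the spanning subgraph (V(G), J); a loop counts twice
  deg : Subset (nE G) → V G → ℕ
  deg J x = foldr _+_ 0
    (map (λ e → if lookup J e
                  then [ proj₁ (ends G e) ≟ᵇ x ] + [ proj₂ (ends G e) ≟ᵇ x ]
                  else 0)
         (allFin (nE G)))

  γsum : ∀ {t} → (E G → GF2^ t) → Subset (nE G) → GF2^ t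
  γsum γ F = foldr _⊕_ 0v
    (map (λ e → if lookup F e then γ e else 0v) (allFin (nE G)))

  IsTJoin : (V G → Set) → Subset (nE G) → Set
  IsTJoin T J = ∀ x → ((deg J x % 2 ≡ 1) → T x) × (T x → deg J x % 2 ≡ 1)

  Is-w̃T : ∀ {t} → (E G → GF2^ t) → (V G → Set) → GF2^ t → ℕ∞ → Set
  Is-w̃T γ T β = IsMin (λ k → ∃[ J ] IsTJoin T J × γsum γ J ≡ β × k ≡ fin ∣ J ∣)

  Joins : E G → V G → V G → Set
  Joins e x y = ends G e ≡ (x , y) ⊎ ends G e ≡ (y , x)

  data Walk : V G → V G → Set where
    []  : ∀ {x} → Walk x x
    _∷⟨_⟩_ : ∀ {x y z} (e : E G) → Joins e x y → Walk y z → Walk x z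

  walkLength : ∀ {x y} → Walk x y → ℕ
  walkLength []          = 0
  walkLength (e ∷⟨ _ ⟩ W) = suc (walkLength W)

  parity : ∀ {t} → (E G → GF2^ t) → ∀ {x y} → Walk x y → GF2^ t
  parity γ []           = 0v
  parity γ (e ∷⟨ _ ⟩ W) = γ e ⊕ parity γ W

  Is-wuv : ∀ {t} → (E G → GF2^ t) → V G → V G → GF2^ t → ℕ∞ → Set
  Is-wuv γ u v β = IsMin (λ k → Σ[ W ∈ Walk u v ] parity γ W ≡ β × k ≡ fin (walkLength W))

  Is-w : ∀ {t} → (E G → GF2^ t) → GF2^ t → ℕ∞ → Set
  Is-w γ β = IsMin (λ k → ∃[ x ] Σ[ W ∈ Walk x x ] parity γ W ≡ β × k ≡ fin (walkLength W))

-- Finite subsets S ⊆ GF(2)^t are represented by duplicate-free lists.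
sumGF : ∀ {t} → List (GF2^ t) → GF2^ t
sumGF = foldr _⊕_ 0v

sumℕ∞ : List ℕ∞ → ℕ∞
sumℕ∞ = foldr _+∞_ (fin 0)

Is-w̃ : ∀ {t} → (GF2^ t → ℕ∞) → GF2^ t → ℕ∞ → Set
Is-w̃ w β = IsMin (λ k → ∃[ S ] Unique S × sumGF S ≡ β × k ≡ sumℕ∞ (map w S))

-- A {u,v}-join J splits into a (u,v)-walk and closed walks that together use every edge of J
-- once: u has odd degree, so some edge uu′ lies in J, and J minus that edge is a {u′,v}-join, to
-- which we recurse; once u = v, a closed walk through an arbitrary edge is peeled off in the same
-- way. Let β be the parity of the walk, so the closed walks have total parity α + β. Two closed
-- walks of equal parity contribute nothing to that sum, so discarding them in pairs leaves a set S of
-- distinct parities summing to α + β with Σ_{δ∈S} w(δ) at most their total length; hence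
-- |J| ≥ w_uv(β) + w̃(α + β). Conversely, the edges used an odd number of times by a (u,v)-walk and
-- some closed walks form a {u,v}-join whose parity is the sum of theirs and whose size is at most
-- their total length.

module Submission where

open import Defs
open import Level using (0ℓ)
open import Algebra.Bundles using (CommutativeMonoid)
open import Algebra.Structures using (IsCommutativeMonoid)
open import Data.Bool using (true; false; not; if_then_else_) renaming (_≟_ to _≟ᴮ_)
open import Data.Bool.Properties using (xor-comm; xor-assoc; xor-same)
open import Data.Nat using (ℕ; zero; suc; _+_; _≤_; _<_; s≤s; _%_)
import Data.Nat as ℕ
import Data.Nat.Properties as ℕ
open import Data.Nat.Induction using (<-wellFounded)
open import Data.Nat.ListAction using (sum)
open import Data.Parity using (Parity; 0ℙ; 1ℙ) renaming (_+_ to _+ℙ_)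
import Data.Parity.Properties as ℙ
open import Data.Fin using (Fin; zero; suc; _≟_)
open import Data.Fin.Subset using (Subset; ⊥; ∣_∣; _∈_)
open import Data.Fin.Subset.Properties using (nonempty?; Empty-unique; ∣⊥∣≡0)
open import Data.Vec using ([]; _∷_; lookup; _[_]%=_; here; there)
open import Data.Vec.Properties using (zipWith-comm; zipWith-assoc; zipWith-identityˡ; ≡-dec)
open import Data.List using (List; []; _∷_; foldr; map; allFin; [_]; _++_)
open import Data.List.Properties using (map-tabulate)
open import Data.List.Membership.Propositional.Properties using (∈-∃++)
import Data.List.Membership.DecPropositional as DecMembership
open import Data.List.Relation.Unary.All.Properties using (¬Any⇒All¬)
open import Data.List.Relation.Unary.AllPairs using (_∷_)
open import Data.List.Relation.Unary.Unique.Propositional using (Unique; [])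
open import Data.List.Relation.Binary.Permutation.Propositional using (_↭_; ↭⇒↭ₛ)
open import Data.List.Relation.Binary.Permutation.Propositional.Properties using (shift; map⁺)
open import Data.List.Relation.Binary.Permutation.Setoid.Properties using (foldr-commMonoid; Unique-resp-↭)
open import Data.Product using (_×_; _,_; ∃; ∃₂; ∃-syntax; Σ; proj₁; proj₂)
import Data.Product as Product
open import Data.Sum using (_⊎_; inj₁; inj₂)
open import Function using (_∘_; id)
open import Induction.WellFounded using (Acc; acc)
open import Relation.Nullary using (¬_; yes; no; contradiction)
open import Relation.Binary.PropositionalEquality
  using (_≡_; refl; sym; trans; cong; cong₂; subst; setoid; isEquivalence; module ≡-Reasoning)

⊕-comm : ∀ {t} (x y : GF2^ t) → x ⊕ y ≡ y ⊕ x
⊕-comm = zipWith-comm xor-comm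

⊕-assoc : ∀ {t} (x y z : GF2^ t) → (x ⊕ y) ⊕ z ≡ x ⊕ (y ⊕ z)
⊕-assoc = zipWith-assoc xor-assoc

⊕-identityˡ : ∀ {t} (x : GF2^ t) → 0v ⊕ x ≡ x
⊕-identityˡ = zipWith-identityˡ (λ _ → refl)

⊕-identityʳ : ∀ {t} (x : GF2^ t) → x ⊕ 0v ≡ x
⊕-identityʳ x = trans (⊕-comm x 0v) (⊕-identityˡ x)

⊕-self : ∀ {t} (x : GF2^ t) → x ⊕ x ≡ 0v
⊕-self []      = refl
⊕-self (a ∷ x) = cong₂ _∷_ (xor-same a) (⊕-self x)

x⊕[x⊕y]≡y : ∀ {t} (x y : GF2^ t) → x ⊕ (x ⊕ y) ≡ y
x⊕[x⊕y]≡y x y = trans (sym (⊕-assoc x x y)) (trans (cong (_⊕ y) (⊕-self x)) (⊕-identityˡ y))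

⊕-0v-isCommutativeMonoid : ∀ t → IsCommutativeMonoid _≡_ (_⊕_ {t}) 0v
⊕-0v-isCommutativeMonoid t = record
  { isMonoid = record
    { isSemigroup = record
      { isMagma = record { isEquivalence = isEquivalence ; ∙-cong = cong₂ _⊕_ }
      ; assoc   = ⊕-assoc }
    ; identity = ⊕-identityˡ , ⊕-identityʳ }
  ; comm = ⊕-comm }

⊕-0v-commutativeMonoid : ℕ → CommutativeMonoid 0ℓ 0ℓ
⊕-0v-commutativeMonoid t = record { isCommutativeMonoid = ⊕-0v-isCommutativeMonoid t }

+∞-identityˡ : ∀ a → fin 0 +∞ a ≡ a
+∞-identityˡ (fin a) = refl
+∞-identityˡ ∞       = refl

+∞-identityʳ : ∀ a → a +∞ fin 0 ≡ a
+∞-identityʳ (fin a) = cong fin (ℕ.+-identityʳ a)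
+∞-identityʳ ∞       = refl

+∞-comm : ∀ a b → a +∞ b ≡ b +∞ a
+∞-comm (fin a) (fin b) = cong fin (ℕ.+-comm a b)
+∞-comm (fin a) ∞       = refl
+∞-comm ∞       (fin b) = refl
+∞-comm ∞       ∞       = refl

+∞-assoc : ∀ a b c → (a +∞ b) +∞ c ≡ a +∞ (b +∞ c)
+∞-assoc (fin a) (fin b) (fin c) = cong fin (ℕ.+-assoc a b c)
+∞-assoc (fin a) (fin b) ∞       = refl
+∞-assoc (fin a) ∞       c       = refl
+∞-assoc ∞       b       c       = refl

+∞-0-isCommutativeMonoid : IsCommutativeMonoid _≡_ _+∞_ (fin 0)
+∞-0-isCommutativeMonoid = record
  { isMonoid = record
    { isSemigroup = record
      { isMagma = record { isEquivalence = isEquivalence ; ∙-cong = cong₂ _+∞_ }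
      ; assoc   = +∞-assoc }
    ; identity = +∞-identityˡ , +∞-identityʳ }
  ; comm = +∞-comm }

≤∞-refl : ∀ {a} → a ≤∞ a
≤∞-refl {fin a} = fin≤fin ℕ.≤-refl
≤∞-refl {∞}     = ∞ ≤∞∞

≤∞-reflexive : ∀ {a b} → a ≡ b → a ≤∞ b
≤∞-reflexive refl = ≤∞-refl

≤∞-trans : ∀ {a b c} → a ≤∞ b → b ≤∞ c → a ≤∞ c
≤∞-trans (fin≤fin p) (fin≤fin q) = fin≤fin (ℕ.≤-trans p q)
≤∞-trans {a} _ (_ ≤∞∞) = a ≤∞∞

≤∞-antisym : ∀ {a b} → a ≤∞ b → b ≤∞ a → a ≡ b
≤∞-antisym (fin≤fin p) (fin≤fin q) = cong fin (ℕ.≤-antisym p q)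
≤∞-antisym (_ ≤∞∞)     (_ ≤∞∞)     = refl

+∞-mono-≤∞ : ∀ {a b c d} → a ≤∞ b → c ≤∞ d → (a +∞ c) ≤∞ (b +∞ d)
+∞-mono-≤∞ (fin≤fin p) (fin≤fin q) = fin≤fin (ℕ.+-mono-≤ p q)
+∞-mono-≤∞ {a} {fin _} {c} _ (_ ≤∞∞) = (a +∞ c) ≤∞∞
+∞-mono-≤∞ {a} {∞}     {c} _ (_ ≤∞∞) = (a +∞ c) ≤∞∞
+∞-mono-≤∞ {a} {c = c} (_ ≤∞∞) _     = (a +∞ c) ≤∞∞

b≤∞a+∞b : ∀ a b → b ≤∞ (a +∞ b)
b≤∞a+∞b (fin a) (fin b) = fin≤fin (ℕ.m≤n+m b a)
b≤∞a+∞b (fin a) ∞       = ∞ ≤∞∞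
b≤∞a+∞b ∞       b       = b ≤∞∞

+∞≡fin⇒ : ∀ a b {k} → a +∞ b ≡ fin k → ∃₂ λ i j → a ≡ fin i × b ≡ fin j × i + j ≡ k
+∞≡fin⇒ (fin i) (fin j) refl = i , j , refl , refl , refl

IsMin-attained : ∀ {X m k} → IsMin X m → m ≡ fin k → X (fin k)
IsMin-attained (inj₁ Xm , _) refl = Xm
IsMin-attained (inj₂ () , _) refl

IsMin-image : ∀ {I : Set} (f : I → ℕ∞) {m} →
  (∀ i → m ≤∞ f i) → (m ≡ ∞ ⊎ ∃ λ i → f i ≤∞ m) → IsMin (λ k → ∃ λ i → k ≡ f i) m
IsMin-image f {m} lower attained = minimal attained , λ { _ (i , refl) → lower i }
  where
  minimal : (m ≡ ∞ ⊎ ∃ λ i → f i ≤∞ m) → (∃ λ i → m ≡ f i) ⊎ m ≡ ∞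
  minimal (inj₁ m≡∞)        = inj₂ m≡∞
  minimal (inj₂ (i , fi≤m)) = inj₁ (i , ≤∞-antisym (lower i) fi≤m)

module SubsetSum {c ℓ} (M : CommutativeMonoid c ℓ) where
  open CommutativeMonoid M
    using (Carrier; _≈_; _∙_; ε; assoc; identityˡ; ∙-congˡ; ∙-congʳ; commutativeSemigroup)
    renaming (refl to ≈-refl; sym to ≈-sym)
  open import Relation.Binary.Reasoning.Setoid (CommutativeMonoid.setoid M)
  open import Algebra.Properties.CommutativeSemigroup commutativeSemigroup using (x∙yz≈y∙xz)

  -- Defs' γsum and deg are Σ⟨_⟩ over GF(2)^t and over ℕ, definitionally.
  Σ⟨_⟩ : ∀ {m} → Subset m → (Fin m → Carrier) → Carrier
  Σ⟨_⟩ {m} J f = foldr _∙_ ε (map (λ e → if lookup J e then f e else ε) (allFin m))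

  Σ-∷ : ∀ {m} b (J : Subset m) f → Σ⟨ b ∷ J ⟩ f ≡ (if b then f zero else ε) ∙ Σ⟨ J ⟩ (f ∘ suc)
  Σ-∷ b J f = cong (λ xs → _ ∙ foldr _∙_ ε xs)
    (trans (map-tabulate suc summand) (sym (map-tabulate id (summand ∘ suc))))
    where
    summand : Fin _ → Carrier
    summand e = if lookup (b ∷ J) e then f e else ε

  Σ-⊥ : ∀ {m} f → Σ⟨ ⊥ {m} ⟩ f ≈ ε
  Σ-⊥ {zero}  f = ≈-refl
  Σ-⊥ {suc m} f = begin
    Σ⟨ ⊥ ⟩ f              ≡⟨ Σ-∷ false ⊥ f ⟩
    ε ∙ Σ⟨ ⊥ ⟩ (f ∘ suc)  ≈⟨ identityˡ _ ⟩
    Σ⟨ ⊥ ⟩ (f ∘ suc)      ≈⟨ Σ-⊥ (f ∘ suc) ⟩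
    ε                     ∎

  module _ (selfInverse : ∀ x → x ∙ x ≈ ε) where

    Σ-toggle : ∀ {m} e (J : Subset m) f → Σ⟨ J [ e ]%= not ⟩ f ≈ f e ∙ Σ⟨ J ⟩ f
    Σ-toggle zero (true ∷ J) f = begin
      Σ⟨ false ∷ J ⟩ f                    ≡⟨ Σ-∷ false J f ⟩
      ε ∙ Σ⟨ J ⟩ (f ∘ suc)                ≈⟨ ∙-congʳ (≈-sym (selfInverse (f zero))) ⟩
      (f zero ∙ f zero) ∙ Σ⟨ J ⟩ (f ∘ suc) ≈⟨ assoc _ _ _ ⟩
      f zero ∙ (f zero ∙ Σ⟨ J ⟩ (f ∘ suc)) ≡⟨ cong (f zero ∙_) (Σ-∷ true J f) ⟨
      f zero ∙ Σ⟨ true ∷ J ⟩ f            ∎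
    Σ-toggle zero (false ∷ J) f = begin
      Σ⟨ true ∷ J ⟩ f                ≡⟨ Σ-∷ true J f ⟩
      f zero ∙ Σ⟨ J ⟩ (f ∘ suc)      ≈⟨ ∙-congˡ (identityˡ _) ⟨
      f zero ∙ (ε ∙ Σ⟨ J ⟩ (f ∘ suc)) ≡⟨ cong (f zero ∙_) (Σ-∷ false J f) ⟨
      f zero ∙ Σ⟨ false ∷ J ⟩ f      ∎
    Σ-toggle (suc e) (b ∷ J) f = begin
      Σ⟨ b ∷ (J [ e ]%= not) ⟩ f                 ≡⟨ Σ-∷ b (J [ e ]%= not) f ⟩
      head ∙ Σ⟨ J [ e ]%= not ⟩ (f ∘ suc)        ≈⟨ ∙-congˡ (Σ-toggle e J (f ∘ suc)) ⟩
      head ∙ (f (suc e) ∙ Σ⟨ J ⟩ (f ∘ suc))      ≈⟨ x∙yz≈y∙xz _ _ _ ⟩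
      f (suc e) ∙ (head ∙ Σ⟨ J ⟩ (f ∘ suc))      ≡⟨ cong (f (suc e) ∙_) (Σ-∷ b J f) ⟨
      f (suc e) ∙ Σ⟨ b ∷ J ⟩ f                   ∎
      where
      head : Carrier
      head = if b then f zero else ε

    x∙xy≈y : ∀ x y → x ∙ (x ∙ y) ≈ y
    x∙xy≈y x y = begin
      x ∙ (x ∙ y) ≈⟨ assoc x x y ⟨
      (x ∙ x) ∙ y ≈⟨ ∙-congʳ (selfInverse x) ⟩
      ε ∙ y       ≈⟨ identityˡ y ⟩
      y           ∎

    xy∙yz≈xz : ∀ x y z → (x ∙ y) ∙ (y ∙ z) ≈ x ∙ z
    xy∙yz≈xz x y z = begin
      (x ∙ y) ∙ (y ∙ z) ≈⟨ assoc x y (y ∙ z) ⟩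
      x ∙ (y ∙ (y ∙ z)) ≈⟨ ∙-congˡ (x∙xy≈y y z) ⟩
      x ∙ z             ∎

open SubsetSum ℕ.+-0-commutativeMonoid using () renaming (Σ⟨_⟩ to Σℕ⟨_⟩; Σ-∷ to Σℕ-∷; Σ-⊥ to Σℕ-⊥)
open SubsetSum ℙ.+-0-commutativeMonoid using ()
  renaming (Σ⟨_⟩ to Σℙ⟨_⟩; Σ-∷ to Σℙ-∷; Σ-toggle to Σℙ-toggle; xy∙yz≈xz to +ℙ-xy∙yz≈xz)

parity-Σ : ∀ {m} (J : Subset m) f → ℕ.parity (Σℕ⟨ J ⟩ f) ≡ Σℙ⟨ J ⟩ (ℕ.parity ∘ f)
parity-Σ []      f = refl
parity-Σ (b ∷ J) f = begin
  ℕ.parity (Σℕ⟨ b ∷ J ⟩ f)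
    ≡⟨ cong ℕ.parity (Σℕ-∷ b J f) ⟩
  ℕ.parity ((if b then f zero else 0) + Σℕ⟨ J ⟩ (f ∘ suc))
    ≡⟨ ℙ.+-homo-+ (if b then f zero else 0) _ ⟩
  ℕ.parity (if b then f zero else 0) +ℙ ℕ.parity (Σℕ⟨ J ⟩ (f ∘ suc))
    ≡⟨ cong₂ _+ℙ_ (parity-if b) (parity-Σ J (f ∘ suc)) ⟩
  (if b then ℕ.parity (f zero) else 0ℙ) +ℙ Σℙ⟨ J ⟩ (ℕ.parity ∘ f ∘ suc)
    ≡⟨ Σℙ-∷ b J (ℕ.parity ∘ f) ⟨
  Σℙ⟨ b ∷ J ⟩ (ℕ.parity ∘ f)
    ∎
  where
  open ≡-Reasoning
  parity-if : ∀ b → ℕ.parity (if b then f zero else 0) ≡ (if b then ℕ.parity (f zero) else 0ℙ)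
  parity-if true  = refl
  parity-if false = refl

+ℙ-self : ∀ p → p +ℙ p ≡ 0ℙ
+ℙ-self = proj₁ ℙ.+-inverse

+ℙ≡1ℙ⇒ : ∀ p q → p +ℙ q ≡ 1ℙ → p ≡ 1ℙ ⊎ q ≡ 1ℙ
+ℙ≡1ℙ⇒ 1ℙ q _   = inj₁ refl
+ℙ≡1ℙ⇒ 0ℙ q q≡1 = inj₂ q≡1

Σℙ≡1ℙ⇒ : ∀ {m} (J : Subset m) g → Σℙ⟨ J ⟩ g ≡ 1ℙ → ∃ λ e → e ∈ J × g e ≡ 1ℙ
Σℙ≡1ℙ⇒ (true ∷ J) g odd with +ℙ≡1ℙ⇒ _ _ (trans (sym (Σℙ-∷ true J g)) odd)
... | inj₁ g₀≡1 = zero , here , g₀≡1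
... | inj₂ odd′ = Product.map suc (Product.map₁ there) (Σℙ≡1ℙ⇒ J (g ∘ suc) odd′)
Σℙ≡1ℙ⇒ (false ∷ J) g odd =
  Product.map suc (Product.map₁ there) (Σℙ≡1ℙ⇒ J (g ∘ suc) (trans (sym (Σℙ-∷ false J g)) odd))

∣p[x]%=not∣≤1+∣p∣ : ∀ {m} x (p : Subset m) → ∣ p [ x ]%= not ∣ ≤ suc ∣ p ∣
∣p[x]%=not∣≤1+∣p∣ zero    (true  ∷ p) = ℕ.m≤n+m ∣ p ∣ 2
∣p[x]%=not∣≤1+∣p∣ zero    (false ∷ p) = ℕ.≤-refl
∣p[x]%=not∣≤1+∣p∣ (suc x) (true  ∷ p) = s≤s (∣p[x]%=not∣≤1+∣p∣ x p)
∣p[x]%=not∣≤1+∣p∣ (suc x) (false ∷ p) = ∣p[x]%=not∣≤1+∣p∣ x p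

x∈p⇒∣p∣≡1+∣p[x]%=not∣ : ∀ {m x} {p : Subset m} → x ∈ p → ∣ p ∣ ≡ suc ∣ p [ x ]%= not ∣
x∈p⇒∣p∣≡1+∣p[x]%=not∣ here                     = refl
x∈p⇒∣p∣≡1+∣p[x]%=not∣ (there {y = true}  x∈p) = cong suc (x∈p⇒∣p∣≡1+∣p[x]%=not∣ x∈p)
x∈p⇒∣p∣≡1+∣p[x]%=not∣ (there {y = false} x∈p) = x∈p⇒∣p∣≡1+∣p[x]%=not∣ x∈p

x∈p⇒∣p[x]%=not∣<∣p∣ : ∀ {m x} {p : Subset m} → x ∈ p → ∣ p [ x ]%= not ∣ < ∣ p ∣
x∈p⇒∣p[x]%=not∣<∣p∣ x∈p = ℕ.≤-reflexive (sym (x∈p⇒∣p∣≡1+∣p[x]%=not∣ x∈p))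

n%2≡1⇒parity≡1ℙ : ∀ n → n % 2 ≡ 1 → ℕ.parity n ≡ 1ℙ
n%2≡1⇒parity≡1ℙ 0             ()
n%2≡1⇒parity≡1ℙ 1             _   = refl
n%2≡1⇒parity≡1ℙ (suc (suc n)) odd = n%2≡1⇒parity≡1ℙ n odd

parity≡1ℙ⇒n%2≡1 : ∀ n → ℕ.parity n ≡ 1ℙ → n % 2 ≡ 1
parity≡1ℙ⇒n%2≡1 0             ()
parity≡1ℙ⇒n%2≡1 1             _   = refl
parity≡1ℙ⇒n%2≡1 (suc (suc n)) odd = parity≡1ℙ⇒n%2≡1 n odd

≡1ℙ⇔⇒≡ : ∀ {p q} → (p ≡ 1ℙ → q ≡ 1ℙ) → (q ≡ 1ℙ → p ≡ 1ℙ) → p ≡ q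
≡1ℙ⇔⇒≡ {0ℙ} {0ℙ} _ _ = refl
≡1ℙ⇔⇒≡ {0ℙ} {1ℙ} _ q⇒p = q⇒p refl
≡1ℙ⇔⇒≡ {1ℙ} {0ℙ} p⇒q _ = sym (p⇒q refl)
≡1ℙ⇔⇒≡ {1ℙ} {1ℙ} _ _ = refl

module _ (G : Graph) where

  -- point x and boundary x y are the indicator vectors of {x} and of {x} + {y} over GF(2).
  point : V G → V G → Parity
  point x z = ℕ.parity ([_≟ᵇ_] G x z)

  point-refl : ∀ x → point x x ≡ 1ℙ
  point-refl x with x ≟ x
  ... | yes _   = refl
  ... | no x≢x = contradiction refl x≢x

  point-≢ : ∀ {x z} → ¬ x ≡ z → point x z ≡ 0ℙ
  point-≢ {x} {z} x≢z with x ≟ z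
  ... | yes x≡z = contradiction x≡z x≢z
  ... | no _    = refl

  point≡1ℙ⇒≡ : ∀ {x z} → point x z ≡ 1ℙ → x ≡ z
  point≡1ℙ⇒≡ {x} {z} p with x ≟ z
  point≡1ℙ⇒≡ {x} {z} _  | yes x≡z = x≡z
  point≡1ℙ⇒≡ {x} {z} () | no _

  boundary : V G → V G → V G → Parity
  boundary x y z = point x z +ℙ point y z

  boundary-comm : ∀ x y z → boundary x y z ≡ boundary y x z
  boundary-comm x y z = ℙ.+-comm (point x z) (point y z)

  boundary-refl : ∀ x z → boundary x x z ≡ 0ℙ
  boundary-refl x z = +ℙ-self (point x z)

  boundary-trans : ∀ x y w z → boundary x y z +ℙ boundary y w z ≡ boundary x w z
  boundary-trans x y w z = +ℙ-xy∙yz≈xz +ℙ-self (point x z) (point y z) (point w z)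

  boundary≡1ℙ⇒ : ∀ {u v z} → boundary u v z ≡ 1ℙ → z ≡ u ⊎ z ≡ v
  boundary≡1ℙ⇒ {u} {v} odd with +ℙ≡1ℙ⇒ (point u _) (point v _) odd
  ... | inj₁ u-odd = inj₁ (sym (point≡1ℙ⇒≡ u-odd))
  ... | inj₂ v-odd = inj₂ (sym (point≡1ℙ⇒≡ v-odd))

  ⇒boundary≡1ℙ : ∀ {u v z} → ¬ u ≡ v → z ≡ u ⊎ z ≡ v → boundary u v z ≡ 1ℙ
  ⇒boundary≡1ℙ {u} {v} u≢v (inj₁ refl) =
    cong₂ _+ℙ_ (point-refl u) (point-≢ (u≢v ∘ sym))
  ⇒boundary≡1ℙ {u} {v} u≢v (inj₂ refl) =
    cong₂ _+ℙ_ (point-≢ u≢v) (point-refl v)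

  incidence : E G → V G → ℕ
  incidence e z = [_≟ᵇ_] G (proj₁ (ends G e)) z + [_≟ᵇ_] G (proj₂ (ends G e)) z

  Joins⇒parity-incidence : ∀ {e x y} → Joins G e x y → ∀ z → ℕ.parity (incidence e z) ≡ boundary x y z
  Joins⇒parity-incidence {e} {x} {y} (inj₁ p) z rewrite p = ℙ.+-homo-+ ([_≟ᵇ_] G x z) ([_≟ᵇ_] G y z)
  Joins⇒parity-incidence {e} {x} {y} (inj₂ p) z rewrite p =
    trans (ℙ.+-homo-+ ([_≟ᵇ_] G y z) _) (boundary-comm y x z)

  degreeParity : Subset (nE G) → V G → Parity
  degreeParity J z = ℕ.parity (deg G J z)

  degreeParity≡Σ : ∀ J z → degreeParity J z ≡ Σℙ⟨ J ⟩ (λ e → ℕ.parity (incidence e z))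
  degreeParity≡Σ J z = parity-Σ J (λ e → incidence e z)

  degreeParity-⊥ : ∀ z → degreeParity ⊥ z ≡ 0ℙ
  degreeParity-⊥ z = cong ℕ.parity (Σℕ-⊥ (λ e → incidence e z))

  degreeParity-toggle : ∀ {e x y} J → Joins G e x y → ∀ z →
                        degreeParity (J [ e ]%= not) z ≡ boundary x y z +ℙ degreeParity J z
  degreeParity-toggle {e} {x} {y} J j z = begin
    degreeParity (J [ e ]%= not) z
      ≡⟨ degreeParity≡Σ (J [ e ]%= not) z ⟩
    Σℙ⟨ J [ e ]%= not ⟩ parity-incidence
      ≡⟨ Σℙ-toggle +ℙ-self e J parity-incidence ⟩
    ℕ.parity (incidence e z) +ℙ Σℙ⟨ J ⟩ parity-incidence
      ≡⟨ cong₂ _+ℙ_ (sym (Joins⇒parity-incidence j z)) (degreeParity≡Σ J z) ⟨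
    boundary x y z +ℙ degreeParity J z
      ∎
    where
    open ≡-Reasoning
    parity-incidence : E G → Parity
    parity-incidence e = ℕ.parity (incidence e z)

  odd-vertex-has-edge : ∀ J x → degreeParity J x ≡ 1ℙ → ∃₂ λ e y → e ∈ J × Joins G e x y
  odd-vertex-has-edge J x odd with Σℙ≡1ℙ⇒ J _ (trans (sym (degreeParity≡Σ J x)) odd)
  ... | e , e∈J , e-odd with boundary≡1ℙ⇒ (trans (sym (Joins⇒parity-incidence (inj₁ refl) x)) e-odd)
  ...   | inj₁ x≡a = e , b , e∈J , subst (λ a → Joins G e a b) (sym x≡a) (inj₁ refl)
    where b = proj₂ (ends G e)
  ...   | inj₂ x≡b = e , a , e∈J , subst (λ b → Joins G e b a) (sym x≡b) (inj₂ refl)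
    where a = proj₁ (ends G e)

  IsTJoin⇒degreeParity≡boundary : ∀ {u v} J → ¬ u ≡ v → IsTJoin G (λ x → x ≡ u ⊎ x ≡ v) J →
                                  ∀ z → degreeParity J z ≡ boundary u v z
  IsTJoin⇒degreeParity≡boundary J u≢v tj z = ≡1ℙ⇔⇒≡
    (λ odd → ⇒boundary≡1ℙ u≢v (proj₁ (tj z) (parity≡1ℙ⇒n%2≡1 (deg G J z) odd)))
    (λ ∂z → n%2≡1⇒parity≡1ℙ (deg G J z) (proj₂ (tj z) (boundary≡1ℙ⇒ ∂z)))

  degreeParity≡boundary⇒IsTJoin : ∀ {u v} J → ¬ u ≡ v → (∀ z → degreeParity J z ≡ boundary u v z) →
                                  IsTJoin G (λ x → x ≡ u ⊎ x ≡ v) J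
  degreeParity≡boundary⇒IsTJoin J u≢v ∂J z =
    (λ odd → boundary≡1ℙ⇒ (trans (sym (∂J z)) (n%2≡1⇒parity≡1ℙ (deg G J z) odd))) ,
    (λ Tz → parity≡1ℙ⇒n%2≡1 (deg G J z) (trans (∂J z) (⇒boundary≡1ℙ u≢v Tz)))

module _ (G : Graph) {t} (γ : E G → GF2^ t) where
  open SubsetSum (⊕-0v-commutativeMonoid t) using () renaming (Σ-toggle to Σ⊕-toggle; Σ-⊥ to Σ⊕-⊥)

  γsum-toggle : ∀ e J → γsum G γ (J [ e ]%= not) ≡ γ e ⊕ γsum G γ J
  γsum-toggle e J = Σ⊕-toggle ⊕-self e J γ

  ClosedWalk : Set
  ClosedWalk = ∃ λ x → Walk G x x

  cyclesLength : List ClosedWalk → ℕ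
  cyclesLength Cs = sum (map (walkLength G ∘ proj₂) Cs)

  cyclesParity : List ClosedWalk → GF2^ t
  cyclesParity Cs = sumGF (map (parity G γ ∘ proj₂) Cs)

  record WalkSystem (u v : V G) : Set where
    constructor walkSystem
    field
      walk   : Walk G u v
      cycles : List ClosedWalk

    systemLength : ℕ
    systemLength = walkLength G walk + cyclesLength cycles

    systemParity : GF2^ t
    systemParity = parity G γ walk ⊕ cyclesParity cycles

  open WalkSystem public

  prepend : ∀ {x y v} e → Joins G e x y → WalkSystem y v → WalkSystem x v
  prepend e j S = walkSystem (e ∷⟨ j ⟩ walk S) (cycles S)

  close : ∀ {x u} → WalkSystem x x → WalkSystem u u
  close S = walkSystem [] ((_ , walk S) ∷ cycles S)

  Decomposition : Subset (nE G) → V G → V G → Set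
  Decomposition J u v = Σ (WalkSystem u v) λ S → systemLength S ≡ ∣ J ∣ × systemParity S ≡ γsum G γ J

  empty-decomposition : ∀ {u} → Decomposition ⊥ u u
  empty-decomposition = walkSystem [] [] , sym (∣⊥∣≡0 (nE G)) , trans (⊕-identityˡ 0v) (sym (Σ⊕-⊥ γ))

  prepend-decomposition : ∀ J {e x y v} (j : Joins G e x y) → e ∈ J →
                          Decomposition (J [ e ]%= not) y v → Decomposition J x v
  prepend-decomposition J {e} j e∈J (S , length≡ , parity≡) =
    prepend e j S , trans (cong suc length≡) (sym (x∈p⇒∣p∣≡1+∣p[x]%=not∣ e∈J)) , parity≡′
    where
    open ≡-Reasoning
    parity≡′ : systemParity (prepend e j S) ≡ γsum G γ J
    parity≡′ = begin
      (γ e ⊕ parity G γ (walk S)) ⊕ cyclesParity (cycles S) ≡⟨ ⊕-assoc (γ e) _ _ ⟩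
      γ e ⊕ systemParity S                                 ≡⟨ cong (γ e ⊕_) (trans parity≡ (γsum-toggle e J)) ⟩
      γ e ⊕ (γ e ⊕ γsum G γ J)                             ≡⟨ x⊕[x⊕y]≡y (γ e) _ ⟩
      γsum G γ J                                           ∎

  close-decomposition : ∀ {J x u} → Decomposition J x x → Decomposition J u u
  close-decomposition (S , length≡ , parity≡) = close S , length≡ , trans (⊕-identityˡ _) parity≡

  decompose : ∀ {u v} J → Acc _<_ ∣ J ∣ → (∀ z → degreeParity G J z ≡ boundary G u v z) →
              Decomposition J u v
  decompose {u} {v} J (acc rec) ∂J with u ≟ v
  ... | no u≢v with odd-vertex-has-edge G J u (trans (∂J u) (⇒boundary≡1ℙ G u≢v (inj₁ refl)))
  ...   | e , x , e∈J , j =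
    prepend-decomposition J j e∈J (decompose (J [ e ]%= not) (rec (x∈p⇒∣p[x]%=not∣<∣p∣ e∈J)) ∂J′)
    where
    open ≡-Reasoning
    ∂J′ : ∀ z → degreeParity G (J [ e ]%= not) z ≡ boundary G x v z
    ∂J′ z = begin
      degreeParity G (J [ e ]%= not) z       ≡⟨ degreeParity-toggle G J j z ⟩
      boundary G u x z +ℙ degreeParity G J z ≡⟨ cong₂ _+ℙ_ (boundary-comm G u x z) (∂J z) ⟩
      boundary G x u z +ℙ boundary G u v z   ≡⟨ boundary-trans G x u v z ⟩
      boundary G x v z                       ∎
  decompose {u} J (acc rec) ∂J | yes refl with nonempty? J
  ... | no J-empty = subst (λ J → Decomposition J u u) (sym (Empty-unique J-empty)) empty-decomposition
  ... | yes (e , e∈J) =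
    close-decomposition {J}
      (prepend-decomposition J (inj₁ refl) e∈J (decompose (J [ e ]%= not) (rec (x∈p⇒∣p[x]%=not∣<∣p∣ e∈J)) ∂J′))
    where
    open ≡-Reasoning
    a b : V G
    a = proj₁ (ends G e)
    b = proj₂ (ends G e)
    ∂J′ : ∀ z → degreeParity G (J [ e ]%= not) z ≡ boundary G b a z
    ∂J′ z = begin
      degreeParity G (J [ e ]%= not) z       ≡⟨ degreeParity-toggle G J (inj₁ refl) z ⟩
      boundary G a b z +ℙ degreeParity G J z ≡⟨ cong (boundary G a b z +ℙ_) (trans (∂J z) (boundary-refl G u z)) ⟩
      boundary G a b z +ℙ 0ℙ                 ≡⟨ ℙ.+-identityʳ _ ⟩
      boundary G a b z                       ≡⟨ boundary-comm G a b z ⟩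
      boundary G b a z                       ∎

  toggleWalk : ∀ {x y} → Walk G x y → Subset (nE G) → Subset (nE G)
  toggleWalk []            J = J
  toggleWalk (e ∷⟨ _ ⟩ W) J = toggleWalk W J [ e ]%= not

  degreeParity-toggleWalk : ∀ {x y} (W : Walk G x y) J z →
                            degreeParity G (toggleWalk W J) z ≡ boundary G x y z +ℙ degreeParity G J z
  degreeParity-toggleWalk {x} [] J z = sym (cong (_+ℙ degreeParity G J z) (boundary-refl G x z))
  degreeParity-toggleWalk {x} {y} (_∷⟨_⟩_ {y = w} e j W) J z = begin
    degreeParity G (toggleWalk W J [ e ]%= not) z
      ≡⟨ degreeParity-toggle G (toggleWalk W J) j z ⟩
    boundary G x w z +ℙ degreeParity G (toggleWalk W J) z
      ≡⟨ cong (boundary G x w z +ℙ_) (degreeParity-toggleWalk W J z) ⟩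
    boundary G x w z +ℙ (boundary G w y z +ℙ degreeParity G J z)
      ≡⟨ ℙ.+-assoc (boundary G x w z) _ _ ⟨
    (boundary G x w z +ℙ boundary G w y z) +ℙ degreeParity G J z
      ≡⟨ cong (_+ℙ degreeParity G J z) (boundary-trans G x w y z) ⟩
    boundary G x y z +ℙ degreeParity G J z
      ∎
    where open ≡-Reasoning

  γsum-toggleWalk : ∀ {x y} (W : Walk G x y) J → γsum G γ (toggleWalk W J) ≡ parity G γ W ⊕ γsum G γ J
  γsum-toggleWalk []            J = sym (⊕-identityˡ _)
  γsum-toggleWalk (e ∷⟨ _ ⟩ W) J =
    trans (γsum-toggle e (toggleWalk W J))
      (trans (cong (γ e ⊕_) (γsum-toggleWalk W J)) (sym (⊕-assoc (γ e) _ _)))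

  ∣toggleWalk∣≤ : ∀ {x y} (W : Walk G x y) J → ∣ toggleWalk W J ∣ ≤ walkLength G W + ∣ J ∣
  ∣toggleWalk∣≤ []            J = ℕ.≤-refl
  ∣toggleWalk∣≤ (e ∷⟨ _ ⟩ W) J = ℕ.≤-trans (∣p[x]%=not∣≤1+∣p∣ e (toggleWalk W J)) (s≤s (∣toggleWalk∣≤ W J))

  toggleCycles : List ClosedWalk → Subset (nE G) → Subset (nE G)
  toggleCycles Cs J = foldr (toggleWalk ∘ proj₂) J Cs

  degreeParity-toggleCycles : ∀ Cs J z → degreeParity G (toggleCycles Cs J) z ≡ degreeParity G J z
  degreeParity-toggleCycles []             J z = refl
  degreeParity-toggleCycles ((x , C) ∷ Cs) J z =
    trans (degreeParity-toggleWalk C (toggleCycles Cs J) z)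
      (trans (cong (_+ℙ _) (boundary-refl G x z)) (degreeParity-toggleCycles Cs J z))

  γsum-toggleCycles : ∀ Cs J → γsum G γ (toggleCycles Cs J) ≡ cyclesParity Cs ⊕ γsum G γ J
  γsum-toggleCycles []             J = sym (⊕-identityˡ _)
  γsum-toggleCycles ((x , C) ∷ Cs) J =
    trans (γsum-toggleWalk C (toggleCycles Cs J))
      (trans (cong (parity G γ C ⊕_) (γsum-toggleCycles Cs J)) (sym (⊕-assoc (parity G γ C) _ _)))

  ∣toggleCycles∣≤ : ∀ Cs J → ∣ toggleCycles Cs J ∣ ≤ cyclesLength Cs + ∣ J ∣
  ∣toggleCycles∣≤ []             J = ℕ.≤-refl
  ∣toggleCycles∣≤ ((x , C) ∷ Cs) J =
    ℕ.≤-trans (∣toggleWalk∣≤ C (toggleCycles Cs J))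
      (ℕ.≤-trans (ℕ.+-monoʳ-≤ (walkLength G C) (∣toggleCycles∣≤ Cs J))
        (ℕ.≤-reflexive (sym (ℕ.+-assoc (walkLength G C) _ _))))

  realise : ∀ {u v} (S : WalkSystem u v) → ∃ λ J →
            (∀ z → degreeParity G J z ≡ boundary G u v z) × ∣ J ∣ ≤ systemLength S × γsum G γ J ≡ systemParity S
  realise {u} {v} (walkSystem W Cs) = toggleWalk W (toggleCycles Cs ⊥) , ∂J , size , parity≡
    where
    ∂J : ∀ z → degreeParity G (toggleWalk W (toggleCycles Cs ⊥)) z ≡ boundary G u v z
    ∂J z = trans (degreeParity-toggleWalk W _ z)
      (trans (cong (boundary G u v z +ℙ_) (trans (degreeParity-toggleCycles Cs ⊥ z) (degreeParity-⊥ G z)))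
        (ℙ.+-identityʳ _))
    size : ∣ toggleWalk W (toggleCycles Cs ⊥) ∣ ≤ walkLength G W + cyclesLength Cs
    size = ℕ.≤-trans (∣toggleWalk∣≤ W _) (ℕ.+-monoʳ-≤ (walkLength G W)
      (ℕ.≤-trans (∣toggleCycles∣≤ Cs ⊥)
        (ℕ.≤-reflexive (trans (cong (cyclesLength Cs +_) (∣⊥∣≡0 (nE G))) (ℕ.+-identityʳ _)))))
    parity≡ : γsum G γ (toggleWalk W (toggleCycles Cs ⊥)) ≡ parity G γ W ⊕ cyclesParity Cs
    parity≡ = trans (γsum-toggleWalk W _)
      (cong (parity G γ W ⊕_)
        (trans (γsum-toggleCycles Cs ⊥) (trans (cong (cyclesParity Cs ⊕_) (Σ⊕-⊥ γ)) (⊕-identityʳ _))))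

module _ {t} (w : GF2^ t → ℕ∞) where
  open DecMembership (≡-dec {n = t} _≟ᴮ_) using (_∈?_)

  cost : List (GF2^ t) → ℕ∞
  cost S = sumℕ∞ (map w S)

  sumGF-↭ : ∀ {S S′} → S ↭ S′ → sumGF S ≡ sumGF S′
  sumGF-↭ S↭S′ = foldr-commMonoid (setoid _) (⊕-0v-isCommutativeMonoid t) (↭⇒↭ₛ S↭S′)

  cost-↭ : ∀ {S S′} → S ↭ S′ → cost S ≡ cost S′
  cost-↭ S↭S′ = foldr-commMonoid (setoid _) +∞-0-isCommutativeMonoid (↭⇒↭ₛ (map⁺ w S↭S′))

  -- Two copies of a parity cancel in the sum, and dropping both can only lower the cost.
  cancel-pairs : ∀ ds → ∃ λ S → Unique S × sumGF S ≡ sumGF ds × cost S ≤∞ cost ds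
  cancel-pairs []       = [] , [] , refl , ≤∞-refl
  cancel-pairs (d ∷ ds) with cancel-pairs ds
  ... | S , S! , sum≡ , cost≤ with d ∈? S
  ...   | no d∉S = d ∷ S , ¬Any⇒All¬ S d∉S ∷ S! , cong (d ⊕_) sum≡ , +∞-mono-≤∞ (≤∞-refl {w d}) cost≤
  ...   | yes d∈S with xs , ys , refl ← ∈-∃++ d∈S = S′ , S′! , sum≡′ , cost≤′
    where
    S′ : List (GF2^ t)
    S′ = xs ++ ys
    S↭dS′ : xs ++ [ d ] ++ ys ↭ d ∷ S′
    S↭dS′ = shift d xs ys
    S′! : Unique S′
    S′! with _ ∷ S′! ← Unique-resp-↭ (setoid _) (↭⇒↭ₛ S↭dS′) S! = S′!
    sum≡′ : sumGF S′ ≡ d ⊕ sumGF ds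
    sum≡′ = trans (sym (x⊕[x⊕y]≡y d (sumGF S′))) (cong (d ⊕_) (trans (sym (sumGF-↭ S↭dS′)) sum≡))
    cost≤′ : cost S′ ≤∞ (w d +∞ cost ds)
    cost≤′ = ≤∞-trans (b≤∞a+∞b (w d) (cost S′))
      (≤∞-trans (≤∞-reflexive (sym (cost-↭ S↭dS′))) (≤∞-trans cost≤ (b≤∞a+∞b (w d) (cost ds))))

module _ (G : Graph) {t} (γ : E G → GF2^ t) {w : GF2^ t → ℕ∞} (Hw : ∀ β → Is-w G γ β (w β)) where

  cost≤cyclesLength : ∀ Cs → cost w (map (parity G γ ∘ proj₂) Cs) ≤∞ fin (cyclesLength G γ Cs)
  cost≤cyclesLength []             = ≤∞-refl
  cost≤cyclesLength ((x , C) ∷ Cs) = +∞-mono-≤∞ (proj₂ (Hw _) _ (x , C , refl , refl)) (cost≤cyclesLength Cs)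

  cost≡fin⇒cycles : ∀ S {j} → cost w S ≡ fin j →
                    ∃ λ Cs → cyclesParity G γ Cs ≡ sumGF S × cyclesLength G γ Cs ≡ j
  cost≡fin⇒cycles []      refl = [] , refl , refl
  cost≡fin⇒cycles (δ ∷ S) cost≡ with +∞≡fin⇒ (w δ) (cost w S) cost≡
  ... | _ , _ , wδ≡ , costS≡ , refl with IsMin-attained (Hw δ) wδ≡ | cost≡fin⇒cycles S costS≡
  ...   | x , C , parity≡ , refl | Cs , parities≡ , refl = (x , C) ∷ Cs , cong₂ _⊕_ parity≡ parities≡ , refl

module MinimumFormula (G : Graph) {t} (γ : E G → GF2^ t) {u v : V G} (u≢v : ¬ u ≡ v)
  {w̃T : GF2^ t → ℕ∞} (HT : ∀ β → Is-w̃T G γ (λ x → x ≡ u ⊎ x ≡ v) β (w̃T β))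
  {wuv : GF2^ t → ℕ∞} (Hwuv : ∀ β → Is-wuv G γ u v β (wuv β))
  {w : GF2^ t → ℕ∞} (Hw : ∀ β → Is-w G γ β (w β))
  {w̃ : GF2^ t → ℕ∞} (Hw̃ : ∀ β → Is-w̃ w β (w̃ β)) where


  w̃T≤system : (S : WalkSystem G γ u v) → w̃T (systemParity S) ≤∞ fin (systemLength S)
  w̃T≤system S with J , ∂J , size , parity≡ ← realise G γ S =
    ≤∞-trans (proj₂ (HT _) _ (J , degreeParity≡boundary⇒IsTJoin G J u≢v ∂J , parity≡ , refl)) (fin≤fin size)

  w̃T≤ : ∀ α β → w̃T α ≤∞ (wuv β +∞ w̃ (α ⊕ β))
  w̃T≤ α β with wuv β +∞ w̃ (α ⊕ β) in sum≡
  ... | ∞     = w̃T α ≤∞∞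
  ... | fin _ with +∞≡fin⇒ (wuv β) (w̃ (α ⊕ β)) sum≡
  ...   | _ , _ , wuv≡ , w̃≡ , refl with IsMin-attained (Hwuv β) wuv≡ | IsMin-attained (Hw̃ (α ⊕ β)) w̃≡
  ...     | W , refl , refl | S , _ , sum≡ , cost≡ with cost≡fin⇒cycles G γ Hw S (sym cost≡)
  ...       | Cs , parities≡ , refl = subst (λ α′ → w̃T α′ ≤∞ _) β⊕[α⊕β]≡α (w̃T≤system (walkSystem W Cs))
    where
    β⊕[α⊕β]≡α : systemParity (walkSystem W Cs) ≡ α
    β⊕[α⊕β]≡α = trans (cong (parity G γ W ⊕_) (trans parities≡ (trans sum≡ (⊕-comm α _)))) (x⊕[x⊕y]≡y _ α)

  w̃T-attained : ∀ α → w̃T α ≡ ∞ ⊎ ∃ λ β → (wuv β +∞ w̃ (α ⊕ β)) ≤∞ w̃T α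
  w̃T-attained α with proj₁ (HT α)
  ... | inj₂ w̃T≡∞ = inj₁ w̃T≡∞
  ... | inj₁ (J , tj , refl , w̃T≡)
          with decompose G γ J (<-wellFounded _) (IsTJoin⇒degreeParity≡boundary G J u≢v tj)
  ...   | walkSystem W Cs , length≡ , parity≡ with cancel-pairs w (map (parity G γ ∘ proj₂) Cs)
  ...     | S , S! , sum≡ , cost≤ = inj₂ (parity G γ W , subst (_ ≤∞_) (sym w̃T≡) bound)
    where
    α⊕β≡ : γsum G γ J ⊕ parity G γ W ≡ sumGF S
    α⊕β≡ = trans (cong (_⊕ parity G γ W) (sym parity≡))
      (trans (⊕-comm _ (parity G γ W)) (trans (x⊕[x⊕y]≡y _ _) (sym sum≡)))
    bound : (wuv (parity G γ W) +∞ w̃ (γsum G γ J ⊕ parity G γ W)) ≤∞ fin ∣ J ∣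
    bound = ≤∞-trans
      (+∞-mono-≤∞ (proj₂ (Hwuv _) _ (W , refl , refl))
        (≤∞-trans (proj₂ (Hw̃ _) _ (S , S! , sym α⊕β≡ , refl)) (≤∞-trans cost≤ (cost≤cyclesLength G γ Hw Cs))))
      (fin≤fin (ℕ.≤-reflexive length≡))

lemma6p3 : (G : Graph) (t : ℕ) (γ : E G → GF2^ t) (α : GF2^ t)
    (u v : V G) → ¬ u ≡ v →
    (w̃T : GF2^ t → ℕ∞) → (∀ β → Is-w̃T G γ (λ x → x ≡ u ⊎ x ≡ v) β (w̃T β)) →
    (wuv : GF2^ t → ℕ∞) → (∀ β → Is-wuv G γ u v β (wuv β)) →
    (w : GF2^ t → ℕ∞) → (∀ β → Is-w G γ β (w β)) →
    (w̃ : GF2^ t → ℕ∞) → (∀ β → Is-w̃ w β (w̃ β)) →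
    IsMin (λ k → ∃[ β ] k ≡ wuv β +∞ w̃ (α ⊕ β)) (w̃T α)
lemma6p3 G t γ α u v u≢v w̃T HT wuv Hwuv w Hw w̃ Hw̃ =
  IsMin-image (λ β → wuv β +∞ w̃ (α ⊕ β)) (w̃T≤ α) (w̃T-attained α)
  where open MinimumFormula G γ u≢v HT Hwuv Hw Hw̃
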